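{- Let $G$ be a graph and $\kappa$ an integer, and let $G'$, $A$, $B$ be constructed from $G$ as in the context. If $G$ has a vertex cover of size at most $\kappa$, then there exists a token jumping reconfiguration sequence from $A$ to $B$ in $G'$ consisting of at most $|V(G)|+\kappa$ token jumps.
   Context: Construction: $G'$ is obtained from a copy of $G$ by adding, for each $v\in V(G)$, two new vertices $s_v,t_v$ with edges $\{s_v,v\},\{v,t_v\}$, and adding two new vertices $s,t$ with edges $\{s,s_v\}$ and $\{t_v,t\}$ for all $v\in V(G)$. Set $A=\{s_v: v\in V(G)\}$ and $B=\{t_v: v\in V(G)\}$. An $s$-$t$-separator is a set $S\subseteq V(G')\setminus\{s,t\}$ such that $s,t$ lie in different components of $G'-S$; minimum means of minimum size. A token jumping reconfiguration sequence from $A$ to $B$ is a sequence $A=S_1,\dots,S_r=B$ of minimum $s$-$t$-separators with $S_i=(S_{i-1}\setminus\{v\})\cup\{u\}$, $v\in S_{i-1}$, $u\in V(G')\setminus S_{i-1}$ for each $i\ge2$; it consists of $r-1$ jumps. -}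

module Defs where

open import Data.Nat using (ℕ; zero; suc; _+_; _≤_)
open import Data.Bool using (Bool; true; false; _∨_)
open import Data.Fin using (Fin)
open import Data.List using (List; _∷_; _++_; map; filter; length; allFin)
open import Data.Product using (Σ; _×_; _,_; ∃₂)
open import Data.Sum using (_⊎_)
open import Relation.Nullary using (¬_)
open import Relation.Binary.PropositionalEquality using (_≡_; _≢_)
open import Relation.Nullary.Decidable using (Dec)
open import Data.Bool.Properties using (T?)
open import Data.Bool using (T)

record Graph (n : ℕ) : Set where
  field
    adj    : Fin n → Fin n → Bool
    sym    : ∀ i j → adj i j ≡ adj j i
    irrefl : ∀ i → adj i i ≡ false
open Graph public

count : {n : ℕ} → (Fin n → Bool) → ℕ
count {n} C = length (filter (λ i → T? (C i)) (allFin n))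

HasVertexCoverOfSize≤ : {n : ℕ} → Graph n → ℕ → Set
HasVertexCoverOfSize≤ {n} G κ =
  Σ (Fin n → Bool) λ C →
    (∀ i j → adj G i j ≡ true → (C i ∨ C j) ≡ true) × count C ≤ κ

data V' (n : ℕ) : Set where
  s t  : V' n
  orig : Fin n → V' n
  sv   : Fin n → V' n
  tv   : Fin n → V' n

allV' : (n : ℕ) → List (V' n)
allV' n = s ∷ t ∷ (map orig (allFin n) ++ map sv (allFin n) ++ map tv (allFin n))

-- Edges of G' (each undirected edge listed in one orientation).
data Edge' {n : ℕ} (G : Graph n) : V' n → V' n → Set where
  e-G  : ∀ {i j} → adj G i j ≡ true → Edge' G (orig i) (orig j)
  e-sv : ∀ i → Edge' G (sv i) (orig i)
  e-tv : ∀ i → Edge' G (orig i) (tv i)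
  e-s  : ∀ i → Edge' G s (sv i)
  e-t  : ∀ i → Edge' G (tv i) t

VSet : ℕ → Set
VSet n = V' n → Bool

size : {n : ℕ} → VSet n → ℕ
size {n} S = length (filter (λ x → T? (S x)) (allV' n))

data Reach {n : ℕ} (G : Graph n) (S : VSet n) : V' n → V' n → Set where
  here : ∀ {x} → S x ≡ false → Reach G S x x
  fwd  : ∀ {x y z} → S x ≡ false → Edge' G x y → Reach G S y z → Reach G S x z
  bwd  : ∀ {x y z} → S x ≡ false → Edge' G y x → Reach G S y z → Reach G S x z

IsSeparator : {n : ℕ} → Graph n → VSet n → Set
IsSeparator G S = S s ≡ false × S t ≡ false × ¬ Reach G S s t

IsMinSeparator : {n : ℕ} → Graph n → VSet n → Set
IsMinSeparator G S = IsSeparator G S × (∀ T → IsSeparator G T → size S ≤ size T)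

Jump : {n : ℕ} → VSet n → VSet n → Set
Jump {n} S S' = ∃₂ λ (v u : V' n) → S v ≡ true × S u ≡ false ×
  (∀ x → (S' x ≡ true) → ((S x ≡ true × x ≢ v) ⊎ x ≡ u)) ×
  (∀ x → ((S x ≡ true × x ≢ v) ⊎ x ≡ u) → S' x ≡ true)

data TJSeq {n : ℕ} (G : Graph n) : VSet n → VSet n → ℕ → Set where
  done : ∀ {S T} → IsMinSeparator G S → (∀ x → S x ≡ T x) → TJSeq G S T 0
  step : ∀ {S S' T k} → IsMinSeparator G S → Jump S S' → TJSeq G S' T k →
         TJSeq G S T (suc k)

setA : (n : ℕ) → VSet n
setA n (sv _) = true
setA n _      = false

setB : (n : ℕ) → VSet n
setB n (tv _) = true
setB n _      = false

-- Every s-t-separator of G' meets each of the n internally disjoint paths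
-- s s_v v t_v t, so minimum separators have n vertices. A set with exactly one
-- token on each path is therefore a minimum separator as soon as it separates, and
-- it does unless some edge uv of G has the token of u at t_u while the token of v
-- is still at s_v: otherwise every vertex reachable from s avoiding the tokens is
-- s, some s_v, or some v whose token sits at t_v.
-- Given a vertex cover C, move the tokens of C from s_v to v, then the remaining
-- tokens from s_v to t_v (their neighbours lie in C and have left s_v), then the
-- tokens of C from v to t_v: n + |C| jumps. This schedule is produced greedily:
-- some jump always keeps the set separating and lowers by one the potential in
-- which a token at s_v costs 2 for v ∈ C and 1 otherwise, a token at v costs 1 and
-- a token at t_v costs 0; the potential starts at n + |C| and ends at 0.
module Submission where

open import Defs hiding (sym)
open import Data.Bool using (Bool; true; false; _∨_; T?; _≟_)
open import Data.Bool.Properties using (¬-not)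
open import Data.Fin using (Fin; zero; suc; punchIn)
open import Data.Fin.Properties using (any?; punchInᵢ≢i) renaming (_≟_ to _≟ᶠ_)
open import Data.List using (List; []; _∷_; _++_; map; filter; length; allFin; tabulate)
open import Data.List.Properties using (map-++; map-∘; map-cong; map-tabulate)
open import Data.Nat using (ℕ; zero; suc; _+_; _≤_; z≤n; s≤s)
import Data.Nat.ListAction as List
open import Data.Nat.ListAction.Properties using (sum-++)
open import Data.Nat.Properties
  using (+-0-commutativeMonoid; +-mono-≤; +-monoʳ-≤; m≤n+m; m≢1+n+m; suc-injective;
         ≤-trans; ≤-reflexive; module ≤-Reasoning)
open import Algebra.Properties.CommutativeMonoid.Sum +-0-commutativeMonoid
  using (sum; sum-cong-≗; sum-remove; sum-replicate-zero; ∑-distrib-+)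
open import Data.Product using (Σ; _×_; _,_)
import Data.Product as Product
open import Data.Sum using (_⊎_; inj₁; inj₂)
import Data.Sum as Sum
open import Data.Vec.Functional using (updateAt)
open import Data.Vec.Functional.Properties using (updateAt-updates; updateAt-minimal)
open import Function using (_∘_; const)
open import Relation.Binary.Definitions using (DecidableEquality)
open import Relation.Binary.PropositionalEquality
open import Relation.Nullary using (yes; no; contradiction; _×-dec_)
open import Relation.Nullary.Decidable using (map′)

private
  variable
    n : ℕ

-- Counting

Bool→ℕ : Bool → ℕ
Bool→ℕ true  = 1
Bool→ℕ false = 0

length-filter-T? : {A : Set} (P : A → Bool) (xs : List A) →
  length (filter (λ x → T? (P x)) xs) ≡ List.sum (map (Bool→ℕ ∘ P) xs)
length-filter-T? P [] = refl
length-filter-T? P (x ∷ xs) with P x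
... | true  = cong suc (length-filter-T? P xs)
... | false = length-filter-T? P xs

sum-map-++ : {A : Set} (f : A → ℕ) (xs ys : List A) →
  List.sum (map f (xs ++ ys)) ≡ List.sum (map f xs) + List.sum (map f ys)
sum-map-++ f xs ys = trans (cong List.sum (map-++ f xs ys)) (sum-++ (map f xs) (map f ys))

sum-tabulate : (f : Fin n → ℕ) → List.sum (tabulate f) ≡ sum f
sum-tabulate {zero}  f = refl
sum-tabulate {suc n} f = cong (f zero +_) (sum-tabulate (f ∘ suc))

sum-map-allFin : (f : Fin n → ℕ) → List.sum (map f (allFin n)) ≡ sum f
sum-map-allFin f = trans (cong List.sum (map-tabulate (λ i → i) f)) (sum-tabulate f)

count≡sum : (C : Fin n → Bool) → count C ≡ sum (Bool→ℕ ∘ C)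
count≡sum {n} C = trans (length-filter-T? C (allFin n)) (sum-map-allFin (Bool→ℕ ∘ C))

sum-const-1 : ∀ n → sum {n} (const 1) ≡ n
sum-const-1 zero    = refl
sum-const-1 (suc n) = cong suc (sum-const-1 n)

sum-mono-≤ : {f g : Fin n → ℕ} → (∀ i → f i ≤ g i) → sum f ≤ sum g
sum-mono-≤ {zero}  f≤g = z≤n
sum-mono-≤ {suc n} f≤g = +-mono-≤ (f≤g zero) (sum-mono-≤ (f≤g ∘ suc))

sum-suc-at : {f g : Fin n → ℕ} (i : Fin n) → f i ≡ suc (g i) →
  (∀ j → j ≢ i → f j ≡ g j) → sum f ≡ suc (sum g)
sum-suc-at {suc n} {f} {g} i fi≡1+gi f≡g = begin
  sum f                                   ≡⟨ sum-remove f ⟩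
  f i + sum (f ∘ punchIn i)               ≡⟨ cong₂ _+_ fi≡1+gi (sum-cong-≗ rest) ⟩
  suc (g i + sum (g ∘ punchIn i))         ≡⟨ cong suc (sum-remove g) ⟨
  suc (sum g)                             ∎
  where
  open ≡-Reasoning
  rest : ∀ j → f (punchIn i j) ≡ g (punchIn i j)
  rest j = f≡g (punchIn i j) (punchInᵢ≢i i j)

pathLoad : VSet n → Fin n → ℕ
pathLoad S i = Bool→ℕ (S (orig i)) + (Bool→ℕ (S (sv i)) + Bool→ℕ (S (tv i)))

size-decomposition : (S : VSet n) →
  size S ≡ Bool→ℕ (S s) + (Bool→ℕ (S t) + sum (pathLoad S))
size-decomposition {n} S =
  trans (length-filter-T? S (allV' n))
        (cong (λ m → Bool→ℕ (S s) + (Bool→ℕ (S t) + m)) paths)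
  where
  open ≡-Reasoning
  b : V' n → ℕ
  b = Bool→ℕ ∘ S
  along : (g : Fin n → V' n) → List.sum (map b (map g (allFin n))) ≡ sum (b ∘ g)
  along g = trans (cong List.sum (sym (map-∘ (allFin n)))) (sum-map-allFin (b ∘ g))
  os ss ts : List (V' n)
  os = map orig (allFin n)
  ss = map sv (allFin n)
  ts = map tv (allFin n)
  paths : List.sum (map b (os ++ ss ++ ts)) ≡ sum (pathLoad S)
  paths = begin
    List.sum (map b (os ++ ss ++ ts))
      ≡⟨ sum-map-++ b os (ss ++ ts) ⟩
    List.sum (map b os) + List.sum (map b (ss ++ ts))
      ≡⟨ cong (List.sum (map b os) +_) (sum-map-++ b ss ts) ⟩
    List.sum (map b os) + (List.sum (map b ss) + List.sum (map b ts))
      ≡⟨ cong₂ _+_ (along orig) (cong₂ _+_ (along sv) (along tv)) ⟩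
    sum (b ∘ orig) + (sum (b ∘ sv) + sum (b ∘ tv))
      ≡⟨ cong (sum (b ∘ orig) +_) (∑-distrib-+ (b ∘ sv) (b ∘ tv)) ⟨
    sum (b ∘ orig) + sum (λ i → b (sv i) + b (tv i))
      ≡⟨ ∑-distrib-+ (b ∘ orig) _ ⟨
    sum (pathLoad S) ∎

size-cong : {S S′ : VSet n} → S ≗ S′ → size S ≡ size S′
size-cong {n} {S} {S′} S≗S′ = begin
  size S                                  ≡⟨ length-filter-T? S (allV' n) ⟩
  List.sum (map (Bool→ℕ ∘ S) (allV' n))   ≡⟨ cong List.sum (map-cong (cong Bool→ℕ ∘ S≗S′) (allV' n)) ⟩
  List.sum (map (Bool→ℕ ∘ S′) (allV' n))  ≡⟨ length-filter-T? S′ (allV' n) ⟨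
  size S′                                 ∎
  where open ≡-Reasoning

-- Separators of G'

module _ {G : Graph n} where

  Reach-start : {S : VSet n} {x y : V' n} → Reach G S x y → S x ≡ false
  Reach-start (here x∉S)    = x∉S
  Reach-start (fwd x∉S _ _) = x∉S
  Reach-start (bwd x∉S _ _) = x∉S

  Reach-cong : {S S′ : VSet n} → S ≗ S′ → {x y : V' n} →
    Reach G S x y → Reach G S′ x y
  Reach-cong S≗S′ (here {x} x∉S)      = here (trans (sym (S≗S′ x)) x∉S)
  Reach-cong S≗S′ (fwd {x} x∉S e r)   = fwd (trans (sym (S≗S′ x)) x∉S) e (Reach-cong S≗S′ r)
  Reach-cong S≗S′ (bwd {x} x∉S e r)   = bwd (trans (sym (S≗S′ x)) x∉S) e (Reach-cong S≗S′ r)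

  IsMinSeparator-cong : {S S′ : VSet n} → S ≗ S′ →
    IsMinSeparator G S′ → IsMinSeparator G S
  IsMinSeparator-cong S≗S′ ((s∉S′ , t∉S′ , unreachable) , minimal) =
    (trans (S≗S′ s) s∉S′ , trans (S≗S′ t) t∉S′ , unreachable ∘ Reach-cong S≗S′) ,
    λ T sep → ≤-trans (≤-reflexive (size-cong S≗S′)) (minimal T sep)

  separator-meets-path : {T : VSet n} → IsSeparator G T → ∀ i → 1 ≤ pathLoad T i
  separator-meets-path {T} (s∉T , t∉T , unreachable) i
    with T (orig i) in vi | T (sv i) in si | T (tv i) in ti
  ... | true  | _     | _     = s≤s z≤n
  ... | false | true  | _     = s≤s z≤n
  ... | false | false | true  = s≤s z≤n
  ... | false | false | false = contradiction
    (fwd s∉T (e-s i) (fwd si (e-sv i) (fwd vi (e-tv i) (fwd ti (e-t i) (here t∉T)))))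
    unreachable

  separator-size-≥ : {T : VSet n} → IsSeparator G T → n ≤ size T
  separator-size-≥ {T} sep = begin
    n                                               ≡⟨ sum-const-1 n ⟨
    sum {n} (const 1)                               ≤⟨ sum-mono-≤ (separator-meets-path sep) ⟩
    sum (pathLoad T)                                ≤⟨ m≤n+m _ (Bool→ℕ (T t)) ⟩
    Bool→ℕ (T t) + sum (pathLoad T)                 ≤⟨ m≤n+m _ (Bool→ℕ (T s)) ⟩
    Bool→ℕ (T s) + (Bool→ℕ (T t) + sum (pathLoad T)) ≡⟨ size-decomposition T ⟨
    size T                                          ∎
    where open ≤-Reasoning

Jump-congˡ : {S S′ S″ : VSet n} → S ≗ S′ → Jump S′ S″ → Jump S S″
Jump-congˡ S≗S′ (v , u , v∈S′ , u∉S′ , from , to) =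
  v , u , trans (S≗S′ v) v∈S′ , trans (S≗S′ u) u∉S′ ,
  (λ x x∈S″ → Sum.map₁ (Product.map₁ (trans (S≗S′ x))) (from x x∈S″)) ,
  (λ x kept → to x (Sum.map₁ (Product.map₁ (trans (sym (S≗S′ x)))) kept))

TJSeq-congˡ : {G : Graph n} {S S′ T : VSet n} {k : ℕ} → S ≗ S′ →
  TJSeq G S′ T k → TJSeq G S T k
TJSeq-congˡ S≗S′ (done min S′≗T)  = done (IsMinSeparator-cong S≗S′ min) (λ x → trans (S≗S′ x) (S′≗T x))
TJSeq-congˡ S≗S′ (step min jump r) = step (IsMinSeparator-cong S≗S′ min) (Jump-congˡ S≗S′ jump) r

-- Token placements: one token on each path s s_v v t_v t

data Place : Set where
  start middle finish : Place

_==_ : Place → Place → Bool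
start  == start  = true
middle == middle = true
finish == finish = true
_      == _      = false

==-refl : (q : Place) → (q == q) ≡ true
==-refl start  = refl
==-refl middle = refl
==-refl finish = refl

==⇒≡ : (q r : Place) → (q == r) ≡ true → q ≡ r
==⇒≡ start  start  _ = refl
==⇒≡ middle middle _ = refl
==⇒≡ finish finish _ = refl

_≟ₚ_ : DecidableEquality Place
q ≟ₚ r = map′ (==⇒≡ q r) (λ { refl → ==-refl q }) ((q == r) ≟ true)

finish-otherwise : (q : Place) → q ≢ start → q ≢ middle → q ≡ finish
finish-otherwise start  ≢start _ = contradiction refl ≢start
finish-otherwise middle _ ≢middle = contradiction refl ≢middle
finish-otherwise finish _ _ = refl

≢⇒==false : {q r : Place} → q ≢ r → (q == r) ≡ false
≢⇒==false {q} {r} q≢r with q == r in q==r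
... | false = refl
... | true  = contradiction (==⇒≡ q r q==r) q≢r

Placement : ℕ → Set
Placement n = Fin n → Place

vertexOf : Fin n → Place → V' n
vertexOf i start  = sv i
vertexOf i middle = orig i
vertexOf i finish = tv i

vertexOf-injective : {i j : Fin n} (q r : Place) → vertexOf i q ≡ vertexOf j r → i ≡ j × q ≡ r
vertexOf-injective start  start  refl = refl , refl
vertexOf-injective middle middle refl = refl , refl
vertexOf-injective finish finish refl = refl , refl
vertexOf-injective start  middle ()
vertexOf-injective start  finish ()
vertexOf-injective middle start  ()
vertexOf-injective middle finish ()
vertexOf-injective finish start  ()
vertexOf-injective finish middle ()

tokens : Placement n → VSet n
tokens p s        = false
tokens p t        = false
tokens p (orig i) = p i == middle
tokens p (sv i)   = p i == start
tokens p (tv i)   = p i == finish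

tokens-vertexOf : (p : Placement n) (i : Fin n) (q : Place) → tokens p (vertexOf i q) ≡ (p i == q)
tokens-vertexOf p i start  = refl
tokens-vertexOf p i middle = refl
tokens-vertexOf p i finish = refl

tokens⇒placed : (p : Placement n) (i : Fin n) {q : Place} → tokens p (vertexOf i q) ≡ true → p i ≡ q
tokens⇒placed p i {q} = ==⇒≡ (p i) q ∘ trans (sym (tokens-vertexOf p i q))

placed⇒tokens : (p : Placement n) (i : Fin n) {q : Place} → p i ≡ q → tokens p (vertexOf i q) ≡ true
placed⇒tokens p i {q} refl = trans (tokens-vertexOf p i q) (==-refl q)

size-tokens : (p : Placement n) → size (tokens p) ≡ n
size-tokens {n} p = trans (size-decomposition (tokens p))
  (trans (sum-cong-≗ (λ i → one-token (p i))) (sum-const-1 n))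
  where
  one-token : (q : Place) → Bool→ℕ (q == middle) + (Bool→ℕ (q == start) + Bool→ℕ (q == finish)) ≡ 1
  one-token start  = refl
  one-token middle = refl
  one-token finish = refl

Admissible : Graph n → Placement n → Set
Admissible G p = ∀ {i j} → adj G i j ≡ true → p i ≡ finish → p j ≢ start

sourceSide : Placement n → V' n → Bool
sourceSide p s        = true
sourceSide p t        = false
sourceSide p (orig i) = p i == finish
sourceSide p (sv i)   = true
sourceSide p (tv i)   = false

module _ {G : Graph n} {p : Placement n} (admissible : Admissible G p) where

  sourceSide-edge : {x y : V' n} → Edge' G x y → tokens p x ≡ false → tokens p y ≡ false →
    sourceSide p x ≡ sourceSide p y
  sourceSide-edge (e-G {i} {j} ij) x∉ y∉ with p i in pi | p j in pj
  ... | start  | start  = refl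
  ... | finish | finish = refl
  ... | finish | start  = contradiction pj (admissible ij pi)
  ... | start  | finish = contradiction pi (admissible (trans (Graph.sym G j i) ij) pj)
  sourceSide-edge (e-G ij) () y∉ | middle | _
  sourceSide-edge (e-G ij) x∉ () | _      | middle
  sourceSide-edge (e-sv i) x∉ y∉ with p i
  ... | finish = refl
  sourceSide-edge (e-sv i) () y∉ | start
  sourceSide-edge (e-sv i) x∉ () | middle
  sourceSide-edge (e-tv i) x∉ y∉ with p i
  ... | start = refl
  sourceSide-edge (e-tv i) () y∉ | middle
  sourceSide-edge (e-tv i) x∉ () | finish
  sourceSide-edge (e-s i)  x∉ y∉ = refl
  sourceSide-edge (e-t i)  x∉ y∉ = refl

  sourceSide-Reach : {x y : V' n} → Reach G (tokens p) x y → sourceSide p x ≡ sourceSide p y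
  sourceSide-Reach (here _)       = refl
  sourceSide-Reach (fwd x∉ e r)   = trans (sourceSide-edge e x∉ (Reach-start r)) (sourceSide-Reach r)
  sourceSide-Reach (bwd x∉ e r)   = trans (sym (sourceSide-edge e (Reach-start r) x∉)) (sourceSide-Reach r)

  tokens-isMinSeparator : IsMinSeparator G (tokens p)
  tokens-isMinSeparator =
    (refl , refl , λ r → contradiction (sourceSide-Reach r) λ ()) ,
    λ T sep → ≤-trans (≤-reflexive (size-tokens p)) (separator-size-≥ sep)

move : Placement n → Fin n → Place → Placement n
move p i w = updateAt p i (const w)

move-other : (p : Placement n) (i j : Fin n) {w q : Place} → move p i w j ≡ q → w ≢ q → p j ≡ q
move-other p i j w′≡q w≢q with j ≟ᶠ i
... | yes refl = contradiction (trans (sym (updateAt-updates i p)) w′≡q) w≢q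
... | no j≢i   = trans (sym (updateAt-minimal j i p j≢i)) w′≡q

tokens-jump : {p : Placement n} {i : Fin n} {w : Place} → p i ≢ w →
  Jump (tokens p) (tokens (move p i w))
tokens-jump {n} {p} {i} {w} pi≢w =
  vertexOf i (p i) , vertexOf i w , placed⇒tokens p i refl ,
  trans (tokens-vertexOf p i w) (≢⇒==false pi≢w) , from , to
  where
  p′ = move p i w

  Kept : V' n → Set
  Kept x = tokens p x ≡ true × x ≢ vertexOf i (p i)

  arrived : ∀ j q → p′ j ≡ q → Kept (vertexOf j q) ⊎ vertexOf j q ≡ vertexOf i w
  arrived j q p′j≡q with j ≟ᶠ i
  ... | yes refl = inj₂ (cong (vertexOf i) (trans (sym p′j≡q) (updateAt-updates i p)))
  ... | no j≢i   = inj₁ (placed⇒tokens p j pj≡q , j≢i ∘ Product.proj₁ ∘ vertexOf-injective q (p i))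
    where pj≡q = trans (sym (updateAt-minimal j i p j≢i)) p′j≡q

  stayed : ∀ j q → Kept (vertexOf j q) → p′ j ≡ q
  stayed j q (x∈ , x≢v) with j ≟ᶠ i
  ... | yes refl = contradiction (cong (vertexOf i) (sym (tokens⇒placed p j x∈))) x≢v
  ... | no j≢i   = trans (updateAt-minimal j i p j≢i) (tokens⇒placed p j x∈)

  from : ∀ x → tokens p′ x ≡ true → Kept x ⊎ x ≡ vertexOf i w
  from (orig j) = arrived j middle ∘ tokens⇒placed p′ j
  from (sv j)   = arrived j start ∘ tokens⇒placed p′ j
  from (tv j)   = arrived j finish ∘ tokens⇒placed p′ j

  to : ∀ x → Kept x ⊎ x ≡ vertexOf i w → tokens p′ x ≡ true
  to _ (inj₂ refl)     = placed⇒tokens p′ i (updateAt-updates i p)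
  to (orig j) (inj₁ k) = placed⇒tokens p′ j (stayed j middle k)
  to (sv j)   (inj₁ k) = placed⇒tokens p′ j (stayed j start k)
  to (tv j)   (inj₁ k) = placed⇒tokens p′ j (stayed j finish k)

module _ (G : Graph n) (p : Placement n) (admissible : Admissible G p) where

  move-to-middle-admissible : (i : Fin n) → Admissible G (move p i middle)
  move-to-middle-admissible i ij p′j≡finish p′k≡start =
    admissible ij (move-other p i _ p′j≡finish λ ()) (move-other p i _ p′k≡start λ ())

  move-to-finish-admissible : (i : Fin n) → (∀ {k} → adj G i k ≡ true → p k ≢ start) →
    Admissible G (move p i finish)
  move-to-finish-admissible i no-start-neighbour {j} ij p′j≡finish p′k≡start
    with pk≡start ← move-other p i _ p′k≡start (λ ()) | j ≟ᶠ i
  ... | yes refl = no-start-neighbour ij pk≡start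
  ... | no j≢i   = admissible ij (trans (sym (updateAt-minimal j i p j≢i)) p′j≡finish) pk≡start

-- The greedy reconfiguration

cost : Bool → Place → ℕ
cost c start  = suc (Bool→ℕ c)
cost c middle = 1
cost c finish = 0

cost-drop⇒≢ : {c : Bool} {q w : Place} → cost c q ≡ suc (cost c w) → q ≢ w
cost-drop⇒≢ drops refl = m≢1+n+m _ {0} drops

potential : (Fin n → Bool) → Placement n → ℕ
potential C p = sum λ i → cost (C i) (p i)

potential-move : (C : Fin n → Bool) {p : Placement n} {i : Fin n} {w : Place} →
  cost (C i) (p i) ≡ suc (cost (C i) w) → potential C p ≡ suc (potential C (move p i w))
potential-move C {p} {i} {w} drops = sum-suc-at i
  (trans drops (cong (suc ∘ cost (C i)) (sym (updateAt-updates i p))))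
  (λ j j≢i → cong (cost (C j)) (sym (updateAt-minimal j i p j≢i)))

potential-finished : (C : Fin n → Bool) {p : Placement n} → (∀ i → p i ≡ finish) → potential C p ≡ 0
potential-finished {n} C finished =
  trans (sum-cong-≗ (λ i → cong (cost (C i)) (finished i))) (sum-replicate-zero n)

potential-initial : (C : Fin n → Bool) → potential C (const start) ≡ n + count C
potential-initial {n} C = trans (∑-distrib-+ (const 1) (Bool→ℕ ∘ C))
  (cong₂ _+_ (sum-const-1 n) (sym (count≡sum C)))

tokens-finished : {p : Placement n} → (∀ i → p i ≡ finish) → tokens p ≗ setB n
tokens-finished finished s        = refl
tokens-finished finished t        = refl
tokens-finished finished (orig j) = cong (_== middle) (finished j)
tokens-finished finished (sv j)   = cong (_== start) (finished j)
tokens-finished finished (tv j)   = cong (_== finish) (finished j)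

setA≗tokens-start : setA n ≗ tokens (const start)
setA≗tokens-start s        = refl
setA≗tokens-start t        = refl
setA≗tokens-start (orig _) = refl
setA≗tokens-start (sv _)   = refl
setA≗tokens-start (tv _)   = refl

Covers : Graph n → (Fin n → Bool) → Set
Covers G C = ∀ i j → adj G i j ≡ true → (C i ∨ C j) ≡ true

record Move (G : Graph n) (C : Fin n → Bool) (p : Placement n) : Set where
  constructor mkMove
  field
    vertex     : Fin n
    target     : Place
    drops      : cost (C vertex) (p vertex) ≡ suc (cost (C vertex) target)
    admissible : Admissible G (move p vertex target)

module _ {G : Graph n} {C : Fin n → Bool} (cover : Covers G C) where

  next-move : {p : Placement n} → Admissible G p → (∀ i → p i ≡ finish) ⊎ Move G C p
  next-move {p} adm with any? (λ i → C i ≟ true ×-dec p i ≟ₚ start)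
  ... | yes (i , Ci , pi) =
    inj₂ (mkMove i middle (cong₂ cost Ci pi) (move-to-middle-admissible G p adm i))
  ... | no no-cover-start with any? (λ i → p i ≟ₚ start)
  ...   | yes (i , pi) =
    inj₂ (mkMove i finish (cong₂ cost (outside pi) pi) (move-to-finish-admissible G p adm i neighbours))
    where
    outside : ∀ {j} → p j ≡ start → C j ≡ false
    outside {j} pj = ¬-not λ Cj → no-cover-start (j , Cj , pj)
    neighbours : ∀ {k} → adj G i k ≡ true → p k ≢ start
    neighbours {k} ik pk =
      contradiction (trans (sym (cong₂ _∨_ (outside pi) (outside pk))) (cover i k ik)) λ ()
  ...   | no no-start with any? (λ i → p i ≟ₚ middle)
  ...     | yes (i , pi) =
    inj₂ (mkMove i finish (cong (cost (C i)) pi)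
                 (move-to-finish-admissible G p adm i λ _ pk → no-start (_ , pk)))
  ...     | no no-middle =
    inj₁ λ i → finish-otherwise (p i) (no-start ∘ (i ,_)) (no-middle ∘ (i ,_))

  reconfigure : ∀ m (p : Placement n) → Admissible G p → potential C p ≡ m →
    TJSeq G (tokens p) (setB n) m
  reconfigure m p adm φ≡m with next-move adm
  ... | inj₁ finished = subst (TJSeq G (tokens p) (setB n)) (trans (sym (potential-finished C finished)) φ≡m)
                          (done (tokens-isMinSeparator adm) (tokens-finished finished))
  reconfigure zero p adm φ≡0 | inj₂ (mkMove i w drops _) =
    contradiction (trans (sym (potential-move C drops)) φ≡0) λ ()
  reconfigure (suc m) p adm φ≡1+m | inj₂ (mkMove i w drops adm′) =
    step (tokens-isMinSeparator adm) (tokens-jump (cost-drop⇒≢ drops))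
         (reconfigure m (move p i w) adm′ (suc-injective (trans (sym (potential-move C drops)) φ≡1+m)))

lemma5 : {n : ℕ} (G : Graph n) (κ : ℕ) → HasVertexCoverOfSize≤ G κ →
    Σ ℕ (λ k → TJSeq G (setA n) (setB n) k × k ≤ n + κ)
lemma5 {n} G κ (C , cover , small) =
  potential C (const start) ,
  TJSeq-congˡ setA≗tokens-start (reconfigure cover _ (const start) (λ _ ()) refl) ,
  ≤-trans (≤-reflexive (potential-initial C)) (+-monoʳ-≤ n small)
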